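{- Let $T=(V,H)$ be a rooted tree with $m=|H|$ edges and let $\mathcal{I}$ be a set of intervals, each interval being a pair $(u,v)$ of nodes with $u$ an ancestor of $v$, identified with the set of edges on the tree path from $u$ to $v$. Consider the set system $(H,\mathcal{S})$ with $\mathcal{S}=\{I : I\in\mathcal{I}\}$ (each interval viewed as a set of edges). Then $(H,\mathcal{S})$ is a $2$-SNC set system, and its layer decomposition with respect to $\tau=2$ has decomposition length $O(\log m)$.
   Context: For a set system $(E,\mathcal{S})$, $X\subseteq E$ and $e\in X$, let $\mathcal{Q}$ be the collection of sets containing $e$; $e$ is a $\tau$-SNC element within $X$ if for every $\mathcal{P}\subseteq\mathcal{Q}$ there are $S_1,\dots,S_r\in\mathcal{P}$, $r\le\tau$, with $\bigcup_{S\in\mathcal{P}}(S\cap X)=\bigcup_{i=1}^r(S_i\cap X)$. The system is $\tau$-SNC if every nonempty $X\subseteq E$ contains a $\tau$-SNC element within $X$. Layer decomposition (w.r.t. $\tau$): $Z_1$ is the set of $\tau$-SNC elements within $E$; for $k\ge2$, $Z_k$ is the set of $\tau$-SNC elements within $E\setminus(Z_1\cup\dots\cup Z_{k-1})$; the process stops when no elements remain, and the number of layers is the decomposition length. -}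

module Defs where

open import Data.Nat using (ℕ; zero; suc; _≤_)
open import Data.Fin using (Fin; zero; suc; toℕ)
open import Data.Fin.Subset using (Subset; _∈_; _∉_; ⊤; Nonempty)
open import Data.List using (List; length)
open import Data.List.Relation.Unary.All using (All)
open import Data.List.Relation.Unary.Any using (Any)
import Data.List.Membership.Propositional as LM
open import Data.Product using (Σ; ∃; _×_)
open import Relation.Nullary using (¬_)
open import Relation.Binary.PropositionalEquality using (_≡_)
open import Function.Bundles using (_⇔_)

Family : ℕ → ℕ → Set₁
Family m k = Fin k → (Fin m → Set)

UnionCap : ∀ {m k} → Family m k → Subset m → List (Fin k) → Fin m → Set
UnionCap 𝒮 X P x = Any (λ j → 𝒮 j x × x ∈ X) P

SNCWithin : ∀ {m k} → ℕ → Family m k → Subset m → Fin m → Set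
SNCWithin {m} {k} τ 𝒮 X e =
  e ∈ X ×
  ((P : List (Fin k)) → All (λ j → 𝒮 j e) P →
    Σ (List (Fin k)) λ Q →
      length Q ≤ τ ×
      All (λ j → j LM.∈ P) Q ×
      ((x : Fin m) → UnionCap 𝒮 X P x ⇔ UnionCap 𝒮 X Q x))

IsSNC : ∀ {m k} → ℕ → Family m k → Set
IsSNC {m} τ 𝒮 = (X : Subset m) → Nonempty X → ∃ λ e → SNCWithin τ 𝒮 X e

-- Layer decomposition, described by the remaining sets
-- R 0 = E,  R (k+1) = R k \ Z_(k+1),  Z_(k+1) = τ-SNC elements within R k.
IsLayerRemainders : ∀ {m k} → ℕ → Family m k → (ℕ → Subset m) → Set
IsLayerRemainders {m} τ 𝒮 R =
  (R 0 ≡ ⊤) ×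
  ((i : ℕ) (e : Fin m) →
    (e ∈ R (suc i)) ⇔ (e ∈ R i × ¬ SNCWithin τ 𝒮 (R i) e))

DecompLengthAtMost : ∀ {m k} → ℕ → Family m k → ℕ → Set
DecompLengthAtMost {m} τ 𝒮 L =
  Σ (ℕ → Subset m) λ R →
    IsLayerRemainders τ 𝒮 R × ((e : Fin m) → e ∉ R L)

-- Rooted trees with m edges: nodes Fin (suc m), root = node 0,
-- node (suc i) has parent  par i  with  toℕ (par i) ≤ toℕ i.
-- Edge i ∈ Fin m is the edge between node (suc i) and its parent.

IsRootedTree : ∀ {m} → (Fin m → Fin (suc m)) → Set
IsRootedTree {m} par = (i : Fin m) → toℕ (par i) ≤ toℕ i

data Anc {m : ℕ} (par : Fin m → Fin (suc m)) : Fin (suc m) → Fin (suc m) → Set where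
  here : ∀ {u} → Anc par u u
  step : ∀ {u i} → Anc par u (par i) → Anc par u (suc i)

-- Edge i lies on the tree path from u to v (u an ancestor of v):
-- its lower endpoint is an ancestor-or-self of v and its upper
-- endpoint is a descendant-or-self of u.
OnPath : ∀ {m} → (Fin m → Fin (suc m)) → Fin (suc m) → Fin (suc m) → Fin m → Set
OnPath par u v i = Anc par (suc i) v × Anc par u (par i)

intervalFamily : ∀ {m k} → (Fin m → Fin (suc m)) →
                 (Fin k → Fin (suc m) × Fin (suc m)) → Family m k
intervalFamily par I j = OnPath par (Data.Product.proj₁ (I j)) (Data.Product.proj₂ (I j))

module Submission where

open import Defs
open import Data.Nat using (ℕ; suc; _+_; _*_)
open import Data.Nat.Logarithm using (⌊log₂_⌋)
open import Data.Fin using (Fin)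
open import Data.Product using (Σ; _×_; proj₁; proj₂)

open import Data.Nat using (zero; _≤_; _^_; z≤n; s≤s)
open import Data.Nat.Properties
  using (≤-refl; m≤n⇒m≤1+n; ≤-trans; module ≤-Reasoning; +-suc; +-mono-≤; +-identityʳ; *-identityˡ; m+1+n≰m)
open import Data.Nat.Logarithm using (⌊log₂⌋-mono-≤; ⌊log₂[2^n]⌋≡n)
open import Data.Fin using (zero; suc; toℕ) renaming (_<_ to _<ᶠ_; _>_ to _>ᶠ_)
open import Data.Fin.Properties using (_≟_; all?; any?)
open import Data.Fin.Induction using (<-wellFounded; >-wellFounded)
open import Data.Fin.Subset using (Subset; _∈_; _⊆_; _∪_; ∣_∣; ⊤; Nonempty; inside; outside)
open import Data.Fin.Subset.Properties
  using (_∈?_; anySubset?; p⊆q⇒∣p∣≤∣q∣; ∣p∣≤n; x∈p∪q⁻; ∣⁅x⁆∣≡1; x∈⁅y⁆⇒x≡y)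
open import Data.Product using (∃; _,_)
open import Data.Sum using (_⊎_; inj₁; inj₂; [_,_])
open import Data.Empty using (⊥; ⊥-elim)
open import Data.List using (List; []; _∷_; length; filter; allFin)
open import Data.List.Relation.Unary.All as All using (All; []; _∷_)
open import Data.List.Relation.Unary.Any using (here; there) renaming (any? to anyₗ?)
open import Data.List.Membership.Propositional using (find; lose) renaming (_∈_ to _∈ₗ_)
open import Data.List.Membership.Propositional.Properties using (∈-filter⁺; ∈-filter⁻; ∈-allFin)
import Data.List.Membership.DecPropositional as DecMembership
open import Data.Vec using (tabulate; []; _∷_; here; there)
open import Data.Vec.Properties using (lookup∘tabulate; []=⇒lookup; lookup⇒[]=)
open import Induction.WellFounded using (Acc; acc)
open import Relation.Nullary using (Dec; yes; no; ¬_; does; ¬?)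
open import Relation.Nullary.Decidable using (_×-dec_; _→-dec_; _⊎-dec_; map′; decidable-stable)
open import Relation.Binary.PropositionalEquality using (_≡_; refl; sym; trans; subst; cong)
open import Function using (id)
open import Function.Bundles using (_⇔_; mk⇔; Equivalence)
import Function.Properties.Equivalence as ⇔

-- (1) The X-elements "strictly below" an edge e (in the subtree under e)
--     may form a chain.  If they do, then e is a 2-SNC element within X:
--     among intervals through e, one with the highest top covers every
--     X-edge on or above e, and one reaching deepest into the chain
--     covers every X-edge below e.
-- (2) Every nonempty X has an edge with no X-edge below it; the chain
--     condition holds vacuously, so the interval system is 2-SNC.
-- (3) For the layer decomposition, an edge surviving i+1 layers is not
--     2-SNC within the i-th remainder, so by (1) it has two incomparable
--     surviving edges below it, whose subtrees are disjoint.  By induction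
--     an edge surviving i layers has at least 2^i edges in its subtree,
--     hence nothing survives ⌊log₂ m⌋ + 1 layers.
--
-- To define the remainders we need 2-SNC-ness to be decidable; this holds
-- for every decidable family over a finite ground set and every τ, by
-- quantifying over subsets of indices instead of lists of indices.

⟦_⟧ : ∀ {n} {P : Fin n → Set} → (∀ x → Dec (P x)) → Subset n
⟦ P? ⟧ = tabulate (λ x → does (P? x))

∈⟦⟧ : ∀ {n} {P : Fin n → Set} (P? : ∀ x → Dec (P x)) x → x ∈ ⟦ P? ⟧ ⇔ P x
∈⟦⟧ P? x = mk⇔ (λ x∈ → fromDoes (P? x) (trans (sym (lookup∘tabulate _ x)) ([]=⇒lookup x∈)))
                (λ px → lookup⇒[]= x _ (trans (lookup∘tabulate _ x) (toDoes (P? x) px)))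
  where
  fromDoes : ∀ {A : Set} (a? : Dec A) → does a? ≡ inside → A
  fromDoes (yes a) _ = a
  fromDoes (no _) ()
  toDoes : ∀ {A : Set} (a? : Dec A) → A → does a? ≡ inside
  toDoes (yes _) _ = refl
  toDoes (no ¬a) a = ⊥-elim (¬a a)

drop-disjoint : ∀ {n s t} {p q : Subset n} →
                (∀ {x} → x ∈ s ∷ p → x ∈ t ∷ q → ⊥) → (∀ {x} → x ∈ p → x ∈ q → ⊥)
drop-disjoint disj x∈p x∈q = disj (there x∈p) (there x∈q)

∣p∣+∣q∣≤∣p∪q∣ : ∀ {n} (p q : Subset n) → (∀ {x} → x ∈ p → x ∈ q → ⊥) →
                ∣ p ∣ + ∣ q ∣ ≤ ∣ p ∪ q ∣
∣p∣+∣q∣≤∣p∪q∣ [] [] _ = z≤n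
∣p∣+∣q∣≤∣p∪q∣ (inside ∷ p) (inside ∷ q) disj = ⊥-elim (disj here here)
∣p∣+∣q∣≤∣p∪q∣ (inside ∷ p) (outside ∷ q) disj = s≤s (∣p∣+∣q∣≤∣p∪q∣ p q (drop-disjoint disj))
∣p∣+∣q∣≤∣p∪q∣ (outside ∷ p) (inside ∷ q) disj =
  subst (_≤ suc ∣ p ∪ q ∣) (sym (+-suc ∣ p ∣ ∣ q ∣)) (s≤s (∣p∣+∣q∣≤∣p∪q∣ p q (drop-disjoint disj)))
∣p∣+∣q∣≤∣p∪q∣ (outside ∷ p) (outside ∷ q) disj = ∣p∣+∣q∣≤∣p∪q∣ p q (drop-disjoint disj)

disjoint-card : ∀ {n} {p q r : Subset n} → p ⊆ r → q ⊆ r → (∀ {x} → x ∈ p → x ∈ q → ⊥) →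
                ∣ p ∣ + ∣ q ∣ ≤ ∣ r ∣
disjoint-card {p = p} {q} p⊆r q⊆r disj =
  ≤-trans (∣p∣+∣q∣≤∣p∪q∣ p q disj) (p⊆q⇒∣p∣≤∣q∣ (λ x∈ → [ p⊆r , q⊆r ] (x∈p∪q⁻ p q x∈)))

member⇒1≤card : ∀ {n} {p : Subset n} {x} → x ∈ p → 1 ≤ ∣ p ∣
member⇒1≤card {x = x} x∈p =
  subst (_≤ _) (∣⁅x⁆∣≡1 x) (p⊆q⇒∣p∣≤∣q∣ (λ y∈ → subst (_∈ _) (sym (x∈⁅y⁆⇒x≡y x y∈)) x∈p))

_⇔-dec_ : ∀ {A B : Set} → Dec A → Dec B → Dec (A ⇔ B)
a? ⇔-dec b? = map′ (λ (f , g) → mk⇔ f g) (λ eq → Equivalence.to eq , Equivalence.from eq)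
                   ((a? →-dec b?) ×-dec (b? →-dec a?))

shortList? : ∀ {k} {P : List (Fin k) → Set} → (∀ Q → Dec (P Q)) →
             ∀ n → Dec (Σ (List (Fin k)) λ Q → length Q ≤ n × P Q)
shortList? P? n with P? []
... | yes p[] = yes ([] , z≤n , p[])
shortList? P? zero | no ¬p[] = no λ { ([] , _ , p) → ¬p[] p }
shortList? P? (suc n) | no ¬p[] with any? (λ a → shortList? (λ Q → P? (a ∷ Q)) n)
... | yes (a , Q , len , p) = yes (a ∷ Q , s≤s len , p)
... | no none = no λ { ([] , _ , p) → ¬p[] p
                     ; (a ∷ Q , s≤s len , p) → none (a , Q , len , p) }

-- For a decidable family over a finite ground set, being a τ-SNC element
-- within X is decidable.  The sub-collections of sets containing e are
-- quantified as subsets of the (finite) index set.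
module SNCDecidable {m k : ℕ} (𝒮 : Family m k) (𝒮? : ∀ j x → Dec (𝒮 j x))
                    (τ : ℕ) (X : Subset m) (e : Fin m) where

  Trace : Subset k → Fin m → Set
  Trace s x = ∃ λ j → j ∈ s × (𝒮 j x × x ∈ X)

  trace⇔union : ∀ {s P} → (∀ j → j ∈ s ⇔ j ∈ₗ P) → ∀ x → Trace s x ⇔ UnionCap 𝒮 X P x
  trace⇔union same x =
    mk⇔ (λ (j , j∈ , p) → lose (Equivalence.to (same j) j∈) p)
        (λ u → let (j , j∈ , p) = find u in j , Equivalence.from (same j) j∈ , p)

  toList : Subset k → List (Fin k)
  toList s = filter (_∈? s) (allFin k)

  toList-same : ∀ s j → j ∈ s ⇔ j ∈ₗ toList s
  toList-same s j = mk⇔ (∈-filter⁺ (_∈? s) (∈-allFin j))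
                        (λ j∈ → proj₂ (∈-filter⁻ (_∈? s) {xs = allFin k} j∈))

  open DecMembership (_≟_ {k}) using () renaming (_∈?_ to _∈ₗ?_)

  toSubset : List (Fin k) → Subset k
  toSubset P = ⟦ (_∈ₗ? P) ⟧

  toSubset-same : ∀ P j → j ∈ toSubset P ⇔ j ∈ₗ P
  toSubset-same P = ∈⟦⟧ (_∈ₗ? P)

  Reduces : Subset k → List (Fin k) → Set
  Reduces s Q = length Q ≤ τ × All (_∈ s) Q × ((x : Fin m) → Trace s x ⇔ UnionCap 𝒮 X Q x)

  ListCondition : Set
  ListCondition = (P : List (Fin k)) → All (λ j → 𝒮 j e) P →
    Σ (List (Fin k)) λ Q →
      length Q ≤ τ × All (_∈ₗ P) Q × ((x : Fin m) → UnionCap 𝒮 X P x ⇔ UnionCap 𝒮 X Q x)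

  SubsetCondition : Set
  SubsetCondition = (s : Subset k) → (∀ j → j ∈ s → 𝒮 j e) → Σ (List (Fin k)) (Reduces s)

  subset⇒list : SubsetCondition → ListCondition
  subset⇒list cond P allP
    with cond (toSubset P) (λ j j∈ → All.lookup allP (Equivalence.to (toSubset-same P j) j∈))
  ... | Q , len , allQ , eqv =
    Q , len , All.map (Equivalence.to (toSubset-same P _)) allQ ,
    λ x → ⇔.trans (⇔.sym (trace⇔union (toSubset-same P) x)) (eqv x)

  list⇒subset : ListCondition → SubsetCondition
  list⇒subset cond s alls
    with cond (toList s) (All.tabulate λ {j} j∈ → alls j (Equivalence.from (toList-same s j) j∈))
  ... | Q , len , allQ , eqv =
    Q , len , All.map (Equivalence.from (toList-same s _)) allQ ,
    λ x → ⇔.trans (trace⇔union (toList-same s) x) (eqv x)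

  trace? : ∀ s x → Dec (Trace s x)
  trace? s x = any? (λ j → (j ∈? s) ×-dec (𝒮? j x ×-dec (x ∈? X)))

  union? : ∀ Q x → Dec (UnionCap 𝒮 X Q x)
  union? Q x = anyₗ? (λ j → 𝒮? j x ×-dec (x ∈? X)) Q

  reduction? : ∀ s → Dec (Σ (List (Fin k)) (Reduces s))
  reduction? s = shortList? (λ Q → All.all? (_∈? s) Q ×-dec all? (λ x → trace? s x ⇔-dec union? Q x)) τ

  containsE? : ∀ s → Dec (∀ j → j ∈ s → 𝒮 j e)
  containsE? s = all? (λ j → (j ∈? s) →-dec 𝒮? j e)

  subsetCondition? : Dec SubsetCondition
  subsetCondition? with anySubset? (λ s → ¬? (containsE? s →-dec reduction? s))
  ... | yes (s , fails) = no λ cond → fails (cond s)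
  ... | no none = yes λ s → decidable-stable (containsE? s →-dec reduction? s) λ fails → none (s , fails)

  snc? : Dec (SNCWithin τ 𝒮 X e)
  snc? = (e ∈? X) ×-dec map′ subset⇒list list⇒subset subsetCondition?

minimum : ∀ {A : Set} {C : A → Set} (R : A → A → Set) →
          (∀ {a b} → C a → C b → R a b ⊎ R b a) →
          (∀ {a b c} → R a b → R b c → R a c) → (∀ {a} → R a a) →
          ∀ {x xs} → All C (x ∷ xs) → Σ A λ b → b ∈ₗ x ∷ xs × (∀ {j} → j ∈ₗ x ∷ xs → R b j)
minimum R total R-trans R-refl {x} {[]} _ = x , here refl , λ { (here refl) → R-refl ; (there ()) }
minimum R total R-trans R-refl {x} {_ ∷ _} (cx ∷ cxs) with minimum R total R-trans R-refl cxs
... | b , b∈ , least with total cx (All.lookup cxs b∈)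
... | inj₁ x≤b = x , here refl , λ { (here refl) → R-refl ; (there j∈) → R-trans x≤b (least j∈) }
... | inj₂ b≤x = b , there b∈ , λ { (here refl) → b≤x ; (there j∈) → least j∈ }

maximal : ∀ {n} (_≺_ : Fin n → Fin n → Set) → (∀ x y → Dec (x ≺ y)) →
          (∀ {x y} → x ≺ y → x <ᶠ y) → (X : Subset n) → Nonempty X →
          Σ (Fin n) λ e → e ∈ X × (∀ y → y ∈ X → ¬ e ≺ y)
maximal _≺_ _≺?_ ≺⇒< X (x , x∈) = climb x x∈ (>-wellFounded x)
  where
  climb : ∀ x → x ∈ X → Acc _>ᶠ_ x → Σ (Fin _) λ e → e ∈ X × (∀ y → y ∈ X → ¬ e ≺ y)
  climb x x∈ (acc higher) with any? (λ y → (y ∈? X) ×-dec (x ≺? y))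
  ... | yes (y , y∈ , x≺y) = climb y y∈ (higher (≺⇒< x≺y))
  ... | no none = x , x∈ , λ y y∈ x≺y → none (y , y∈ , x≺y)

-- Ancestry in a rooted tree; edge i is identified with its lower node suc i.
module Tree {m : ℕ} (par : Fin m → Fin (suc m)) (rooted : IsRootedTree par) where

  anc-trans : ∀ {a b c} → Anc par a b → Anc par b c → Anc par a c
  anc-trans a≤b here = a≤b
  anc-trans a≤b (step b≤c) = step (anc-trans a≤b b≤c)

  anc-comparable : ∀ {a b v} → Anc par a v → Anc par b v → Anc par a b ⊎ Anc par b a
  anc-comparable here b≤v = inj₂ b≤v
  anc-comparable (step a≤v) here = inj₁ (step a≤v)
  anc-comparable (step a≤v) (step b≤v) = anc-comparable a≤v b≤v

  anc-toℕ : ∀ {u v} → Anc par u v → toℕ u ≤ toℕ v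
  anc-toℕ here = ≤-refl
  anc-toℕ {v = suc i} (step u≤p) = m≤n⇒m≤1+n (≤-trans (anc-toℕ u≤p) (rooted i))

  anc? : ∀ u v → Dec (Anc par u v)
  anc? u v = search v (<-wellFounded v)
    where
    search : ∀ v → Acc _<ᶠ_ v → Dec (Anc par u v)
    search v _ with u ≟ v
    ... | yes refl = yes here
    search zero _ | no u≢v = no λ { here → u≢v refl }
    search (suc i) (acc lower) | no u≢v with search (par i) (lower (s≤s (rooted i)))
    ... | yes u≤p = yes (step u≤p)
    ... | no u≰p = no λ { here → u≢v refl ; (step u≤p) → u≰p u≤p }

  _⊑_ : Fin m → Fin m → Set
  x ⊑ y = Anc par (suc x) (suc y)

  Comparable : Fin m → Fin m → Set
  Comparable x y = x ⊑ y ⊎ y ⊑ x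

  comparable? : ∀ x y → Dec (Comparable x y)
  comparable? x y = anc? (suc x) (suc y) ⊎-dec anc? (suc y) (suc x)

  _≺_ : Fin m → Fin m → Set
  e ≺ x = Anc par (suc e) (par x)

  ≺? : ∀ e x → Dec (e ≺ x)
  ≺? e x = anc? (suc e) (par x)

  ≺⇒< : ∀ {e x} → e ≺ x → e <ᶠ x
  ≺⇒< {x = x} e≺x = ≤-trans (anc-toℕ e≺x) (rooted x)

  subtree : Fin m → Subset m
  subtree e = ⟦ (λ z → anc? (suc e) (suc z)) ⟧

  ∈subtree : ∀ e z → z ∈ subtree e ⇔ e ⊑ z
  ∈subtree e = ∈⟦⟧ (λ z → anc? (suc e) (suc z))

  -- Two incomparable edges below e have disjoint subtrees inside that of e.
  fork-size : ∀ {e x y} → e ≺ x → e ≺ y → ¬ Comparable x y →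
              ∣ subtree x ∣ + ∣ subtree y ∣ ≤ ∣ subtree e ∣
  fork-size {e} {x} {y} e≺x e≺y incomparable =
    disjoint-card (inside-e e≺x) (inside-e e≺y)
      λ {z} z∈x z∈y → incomparable (anc-comparable (Equivalence.to (∈subtree x z) z∈x)
                                                   (Equivalence.to (∈subtree y z) z∈y))
    where
    inside-e : ∀ {w} → e ≺ w → subtree w ⊆ subtree e
    inside-e {w} e≺w {z} z∈ =
      Equivalence.from (∈subtree e z) (anc-trans (step e≺w) (Equivalence.to (∈subtree w z) z∈))

module Intervals {m k : ℕ} (par : Fin m → Fin (suc m)) (rooted : IsRootedTree par)
                 (I : Fin k → Fin (suc m) × Fin (suc m)) where
  open Tree par rooted

  top bot : Fin k → Fin (suc m)
  top j = proj₁ (I j)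
  bot j = proj₂ (I j)

  𝒮 : Family m k
  𝒮 = intervalFamily par I

  𝒮? : ∀ j x → Dec (𝒮 j x)
  𝒮? j x = anc? (suc x) (bot j) ×-dec anc? (top j) (par x)

  Chain : Subset m → Fin m → Set
  Chain X e = ∀ {x y} → x ∈ X → y ∈ X → e ≺ x → e ≺ y → Comparable x y

  Fork : Subset m → Fin m → Set
  Fork X e = Σ (Fin m) λ x → Σ (Fin m) λ y → x ∈ X × y ∈ X × e ≺ x × e ≺ y × ¬ Comparable x y

  fork? : ∀ X e x y → Dec (x ∈ X × y ∈ X × e ≺ x × e ≺ y × ¬ Comparable x y)
  fork? X e x y = (x ∈? X) ×-dec (y ∈? X) ×-dec ≺? e x ×-dec ≺? e y ×-dec ¬? (comparable? x y)

  chain⊎fork : ∀ X e → Chain X e ⊎ Fork X e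
  chain⊎fork X e with any? (λ x → any? (fork? X e x))
  ... | yes fork = inj₂ (proj₁ fork , proj₂ fork)
  ... | no none = inj₁ λ {x} {y} x∈ y∈ e≺x e≺y →
    decidable-stable (comparable? x y) λ incomparable → none (x , y , x∈ , y∈ , e≺x , e≺y , incomparable)

  HigherTop : Fin k → Fin k → Set
  HigherTop a b = Anc par (top a) (top b)

  ReachesDeeper : Subset m → Fin m → Fin k → Fin k → Set
  ReachesDeeper X e a b = ∀ x → x ∈ X → e ≺ x → Anc par (suc x) (bot b) → Anc par (suc x) (bot a)

  reachesDeeper-total : ∀ {X e} → Chain X e → ∀ a b → ReachesDeeper X e a b ⊎ ReachesDeeper X e b a
  reachesDeeper-total {X} {e} chain a b
    with all? (λ x → (x ∈? X) →-dec ≺? e x →-dec anc? (suc x) (bot b) →-dec anc? (suc x) (bot a))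
  ... | yes a≥b = inj₁ a≥b
  ... | no a≱b = inj₂ λ x x∈ e≺x x≤a → decidable-stable (anc? (suc x) (bot b)) λ x≰b →
    a≱b λ y y∈ e≺y y≤b → [ (λ y⊑x → anc-trans y⊑x x≤a) , (λ x⊑y → ⊥-elim (x≰b (anc-trans x⊑y y≤b))) ]
                            (chain y∈ x∈ e≺y e≺x)

  covered-by-two : ∀ {X e P t d x} → All (λ j → 𝒮 j e) P → 𝒮 t e → 𝒮 d e →
                   (∀ {j} → j ∈ₗ P → HigherTop t j) → (∀ {j} → j ∈ₗ P → ReachesDeeper X e d j) →
                   UnionCap 𝒮 X P x → UnionCap 𝒮 X (t ∷ d ∷ []) x
  covered-by-two {x = x} allP (e≤t , _) (_ , d≤e) highest deepest u with find u
  ... | j , j∈ , ((x≤j , j≤x) , x∈) with anc-comparable x≤j (proj₁ (All.lookup allP j∈))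
  ... | inj₁ x⊑e = here ((anc-trans x⊑e e≤t , anc-trans (highest j∈) j≤x) , x∈)
  ... | inj₂ here = here ((e≤t , anc-trans (highest j∈) j≤x) , x∈)
  ... | inj₂ (step e≺x) =
    there (here ((deepest j∈ x x∈ e≺x x≤j , anc-trans d≤e (anc-trans (step here) e≺x)) , x∈))

  chain⇒snc : ∀ {X e} → e ∈ X → Chain X e → SNCWithin 2 𝒮 X e
  chain⇒snc {X} {e} e∈ chain = e∈ , reduce
    where
    reduce : (P : List (Fin k)) → All (λ j → 𝒮 j e) P →
      Σ (List (Fin k)) λ Q →
        length Q ≤ 2 × All (_∈ₗ P) Q × ((x : Fin m) → UnionCap 𝒮 X P x ⇔ UnionCap 𝒮 X Q x)
    reduce [] _ = [] , z≤n , [] , λ _ → mk⇔ id id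
    reduce (_ ∷ _) allP
      with minimum HigherTop (λ (_ , a≤e) (_ , b≤e) → anc-comparable a≤e b≤e) anc-trans here allP
         | minimum (ReachesDeeper X e) (λ {a} {b} _ _ → reachesDeeper-total chain a b)
                   (λ a≥b b≥c x x∈ e≺x x≤c → a≥b x x∈ e≺x (b≥c x x∈ e≺x x≤c)) (λ _ _ _ x≤a → x≤a) allP
    ... | t , t∈ , highest | d , d∈ , deepest =
      t ∷ d ∷ [] , s≤s (s≤s z≤n) , t∈ ∷ d∈ ∷ [] ,
      λ x → mk⇔ (covered-by-two allP (All.lookup allP t∈) (All.lookup allP d∈) highest deepest)
                λ { (here p) → lose t∈ p ; (there (here p)) → lose d∈ p }

  isSNC : IsSNC 2 𝒮
  isSNC X nonempty with maximal _≺_ ≺? ≺⇒< X nonempty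
  ... | e , e∈ , lowest = e , chain⇒snc e∈ λ x∈ _ e≺x _ → ⊥-elim (lowest _ x∈ e≺x)

  survives? : (X : Subset m) → ∀ e → Dec (e ∈ X × ¬ SNCWithin 2 𝒮 X e)
  survives? X e = (e ∈? X) ×-dec ¬? (SNCDecidable.snc? 𝒮 𝒮? 2 X e)

  remainder : ℕ → Subset m
  remainder zero = ⊤
  remainder (suc i) = ⟦ survives? (remainder i) ⟧

  remainders-correct : IsLayerRemainders 2 𝒮 remainder
  remainders-correct = refl , λ i → ∈⟦⟧ (survives? (remainder i))

  survivor-size : ∀ i e → e ∈ remainder i → 2 ^ i ≤ ∣ subtree e ∣
  survivor-size zero e _ = member⇒1≤card (Equivalence.from (∈subtree e e) here)
  survivor-size (suc i) e e∈ with Equivalence.to (∈⟦⟧ (survives? (remainder i)) e) e∈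
  ... | e∈i , not-snc with chain⊎fork (remainder i) e
  ... | inj₁ chain = ⊥-elim (not-snc (chain⇒snc e∈i chain))
  ... | inj₂ (x , y , x∈ , y∈ , e≺x , e≺y , incomparable) = begin
    2 ^ i + (2 ^ i + 0)           ≡⟨ cong (2 ^ i +_) (+-identityʳ (2 ^ i)) ⟩
    2 ^ i + 2 ^ i                 ≤⟨ +-mono-≤ (survivor-size i x x∈) (survivor-size i y y∈) ⟩
    ∣ subtree x ∣ + ∣ subtree y ∣ ≤⟨ fork-size e≺x e≺y incomparable ⟩
    ∣ subtree e ∣                 ∎
    where open ≤-Reasoning

  survivor-depth : ∀ L e → e ∈ remainder L → L ≤ ⌊log₂ m ⌋
  survivor-depth L e e∈ = begin
    L               ≡⟨ sym (⌊log₂[2^n]⌋≡n L) ⟩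
    ⌊log₂ 2 ^ L ⌋   ≤⟨ ⌊log₂⌋-mono-≤ (≤-trans (survivor-size L e e∈) (∣p∣≤n (subtree e))) ⟩
    ⌊log₂ m ⌋       ∎
    where open ≤-Reasoning

  exhausted : ∀ e → ¬ e ∈ remainder (1 * ⌊log₂ m ⌋ + 1)
  exhausted e e∈ = m+1+n≰m l (subst (λ n → n + 1 ≤ l) (*-identityˡ l) (survivor-depth (1 * l + 1) e e∈))
    where
    l : ℕ
    l = ⌊log₂ m ⌋

-- Both parts hold for arbitrary pairs of nodes.
mainTheorem4 : ((m : ℕ) (par : Fin m → Fin (suc m)) → IsRootedTree par →
    (k : ℕ) (I : Fin k → Fin (suc m) × Fin (suc m)) →
    ((j : Fin k) → Anc par (proj₁ (I j)) (proj₂ (I j))) →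
    IsSNC 2 (intervalFamily par I))
    ×
    Σ ℕ (λ C →
    (m : ℕ) (par : Fin m → Fin (suc m)) → IsRootedTree par →
    (k : ℕ) (I : Fin k → Fin (suc m) × Fin (suc m)) →
    ((j : Fin k) → Anc par (proj₁ (I j)) (proj₂ (I j))) →
    DecompLengthAtMost 2 (intervalFamily par I) (C * ⌊log₂ m ⌋ + C))
mainTheorem4 = (λ m par rooted k I _ → Intervals.isSNC par rooted I) ,
  (1 , λ m par rooted k I _ → let open Intervals par rooted I in remainder , remainders-correct , exhausted)
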